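{- Let $G=(V,E,\tau)$ be a temporal graph, $s,z\in V$ distinct, and $F(G)$ its flattening with respect to $s,z$. Then: (1) if $S$ is an $(s,z)$-temporal separator in $G$, then there is an $(s,z)$-separator of size at most $\tau|S|$ in $F(G)$; (2) if $S'$ is an $(s,z)$-separator in $F(G)$, then there is an $(s,z)$-temporal separator of size at most $|S'|$ in $G$.
   Context: A temporal graph $G=(V,E,\tau)$ consists of a finite vertex set $V$ and a set of time-labelled undirected edges $E \subseteq V\times V\times[\tau]$ ($(u,v,t')\in E$ iff $(v,u,t')\in E$, no loops). An $(s,z)$-temporal path is a sequence of edges $(u_1,v_1,t_1),\dots,(u_k,v_k,t_k)$ forming a path from $s$ to $z$ with $t_1\le\dots\le t_k$. An $(s,z)$-temporal separator is a set $S\subseteq V\setminus\{s,z\}$ containing a vertex of every $(s,z)$-temporal path. Writing $V\setminus\{s,z\}=\{v_1,\dots,v_n\}$, the flattening $F(G)$ is the static directed graph with vertex set $\{s,z\}\cup\{v_{j,i}: j\in[n], i\in[\tau]\}$ and arcs: $(v_{i,t'},v_{j,t'})$ and $(v_{j,t'},v_{i,t'})$ for each $(v_i,v_j,t')\in E$ with $v_i,v_j\notin\{s,z\}$; $(v_{i,t'},v_{i,t'+1})$ for every $i$ and $t'\in[\tau-1]$; $(s,v_{i,t'})$ for each $(s,v_i,t')\in E$; and $(v_{i,t'},z)$ for each $(z,v_i,t')\in E$. An $(s,z)$-separator in a directed graph is a set of vertices other than $s,z$ whose removal destroys all directed paths from $s$ to $z$. -}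

module Defs where

open import Data.Nat using (ℕ; suc)
open import Data.Fin using (Fin; zero; suc; fromℕ; inject₁; toℕ)
import Data.Fin as F
open import Data.Product using (Σ; ∃; _×_; _,_; proj₁)
open import Data.List using (List)
open import Data.List.Membership.Propositional using (_∈_)
open import Data.List.Relation.Unary.All using (All)
open import Data.List.Relation.Unary.Unique.Propositional using (Unique)
open import Relation.Binary.PropositionalEquality using (_≡_; _≢_)
open import Relation.Nullary using (¬_)
open import Function.Definitions using (Injective)

record TemporalGraph (N τ : ℕ) : Set₁ where
  field
    E      : Fin N → Fin N → Fin τ → Set
    E-sym  : ∀ u v t → E u v t → E v u t
    E-loop : ∀ v t → ¬ E v v t
open TemporalGraph public

module _ {N τ : ℕ} (G : TemporalGraph N τ) (s z : Fin N) where

  record TemporalPath : Set where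
    field
      k     : ℕ
      x     : Fin (suc k) → Fin N
      t     : Fin k → Fin τ
      start : x zero ≡ s
      end   : x (fromℕ k) ≡ z
      edge  : ∀ i → E G (x (inject₁ i)) (x (suc i)) (t i)
      mono  : ∀ i j → i F.≤ j → t i F.≤ t j
      inj   : Injective _≡_ _≡_ x

  -- A finite set of vertices, given as a duplicate-free list; its size is its length.
  -- (s,z)-temporal separator: S ⊆ V ∖ {s,z} meeting every (s,z)-temporal path.
  TemporalSeparator : List (Fin N) → Set
  TemporalSeparator S =
    Unique S × All (λ v → v ≢ s × v ≢ z) S ×
    ((P : TemporalPath) → ∃ λ i → TemporalPath.x P i ∈ S)

  -- Vertices of the flattening: s, z and the copies v_{j,i}
  -- (only copies of vertices v ∉ {s,z} are genuine vertices of F(G);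
  --  other copies have no incident arcs and are never allowed in separators).
  data FVertex : Set where
    src : FVertex
    snk : FVertex
    mid : Fin N → Fin τ → FVertex

  data FArc : FVertex → FVertex → Set where
    edgeArc : ∀ {u v t} → u ≢ s → u ≢ z → v ≢ s → v ≢ z →
              E G u v t → FArc (mid u t) (mid v t)
    timeArc : ∀ {v t t′} → v ≢ s → v ≢ z → toℕ t′ ≡ suc (toℕ t) →
              FArc (mid v t) (mid v t′)
    srcArc  : ∀ {v t} → v ≢ s → v ≢ z → E G s v t → FArc src (mid v t)
    snkArc  : ∀ {v t} → v ≢ s → v ≢ z → E G z v t → FArc (mid v t) snk

  record FlatPath : Set where
    field
      k     : ℕ
      x     : Fin (suc k) → FVertex
      start : x zero ≡ src
      end   : x (fromℕ k) ≡ snk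
      arc   : ∀ i → FArc (x (inject₁ i)) (x (suc i))
      inj   : Injective _≡_ _≡_ x

  FlatSeparator : List (Fin N × Fin τ) → Set
  FlatSeparator S′ =
    Unique S′ × All (λ p → proj₁ p ≢ s × proj₁ p ≢ z) S′ ×
    ((P : FlatPath) → ∃ λ i → Σ (Fin N × Fin τ) λ p →
        p ∈ S′ × FlatPath.x P i ≡ mid (proj₁ p) (Data.Product.proj₂ p))

{-# OPTIONS --safe #-}
-- A directed src–snk path in F(G) enters at a copy v₁@t₁, moves along edges at a fixed time
-- and along time arcs only forwards, and leaves from a copy of a neighbour of z; forgetting the
-- times gives a temporal s–z walk, and erasing its loops a temporal path. That path meets S in
-- some v, and the copies v@t on the flat path lie in S × [τ].
-- Conversely a temporal path s, v₁, …, v_k, z with times t₁ ≤ … lifts to the flat walk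
-- src → v₁@t₁ ⇝ v₁@t₂ → v₂@t₂ ⇝ … → snk that waits along time arcs; after erasing its loops it
-- meets S′ in a copy v@t with v on the temporal path, so the first coordinates of S′ separate.
-- Loops of temporal walks can be erased vertex-wise because times increase along a walk.
module Submission where

open import Defs
open import Data.Nat using (ℕ; zero; suc; _≤_; _*_; _+_; z≤n; s≤s)
import Data.Nat.Properties as ℕ
open import Data.Fin using (Fin; zero; suc; fromℕ; inject₁; toℕ; _≟_)
import Data.Fin as Fin
import Data.Fin.Properties as Fin
open import Data.Fin.Induction using (<-weakInduction-startingFrom)
open import Data.Product using (Σ; ∃; _×_; _,_; proj₁; proj₂)
open import Data.List using (List; []; _∷_; length; map; tabulate; cartesianProduct; allFin; deduplicate; _++_)
open import Data.List.Properties using (length-++; length-map; length-tabulate; length-deduplicate)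
open import Data.List.Membership.Propositional using (_∈_)
open import Data.List.Membership.Propositional.Properties
  using (∈-map⁺; ∈-map⁻; ∈-tabulate⁻; ∈-allFin; ∈-cartesianProduct⁺; ∈-cartesianProduct⁻; ∈-deduplicate⁺)
import Data.List.Membership.DecPropositional as DecMembership
open import Data.List.Relation.Binary.Subset.Propositional using (_⊆_)
open import Data.List.Relation.Binary.Subset.Propositional.Properties using (⊆-reflexive; ∷⁺ʳ)
open import Data.List.Relation.Unary.All using (All; []; _∷_)
import Data.List.Relation.Unary.All as All
import Data.List.Relation.Unary.All.Properties as All
open import Data.List.Relation.Unary.Any using (here; there)
open import Data.List.Relation.Unary.AllPairs using ([]; _∷_)
open import Data.List.Relation.Unary.Unique.Propositional using (Unique)
import Data.List.Relation.Unary.Unique.Propositional.Properties as Unique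
import Data.List.Relation.Unary.Unique.DecPropositional.Properties as Unique
open import Relation.Binary.Construct.Closure.ReflexiveTransitive using (Star; ε; _◅◅_)
import Relation.Binary.Construct.Closure.ReflexiveTransitive as Star
open import Relation.Binary.Definitions using (DecidableEquality)
open import Relation.Binary.PropositionalEquality
  using (_≡_; refl; sym; trans; cong; cong₂; subst; _≢_; ≢-sym; module ≡-Reasoning)
open import Relation.Nullary using (¬_; yes; no)
open import Relation.Nullary.Decidable using (map′; _×-dec_)
open import Relation.Unary using (Pred)
open import Data.Empty using (⊥-elim)
open import Function using (id; _∘_)
open import Function.Definitions using (Injective)

length-cartesianProduct : ∀ {A B : Set} (xs : List A) (ys : List B) →
                          length (cartesianProduct xs ys) ≡ length xs * length ys
length-cartesianProduct []       ys = refl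
length-cartesianProduct (x ∷ xs) ys = begin
  length (map (x ,_) ys ++ cartesianProduct xs ys)
    ≡⟨ length-++ (map (x ,_) ys) ⟩
  length (map (x ,_) ys) + length (cartesianProduct xs ys)
    ≡⟨ cong₂ _+_ (length-map (x ,_) ys) (length-cartesianProduct xs ys) ⟩
  length ys + length xs * length ys
    ∎
  where open ≡-Reasoning

Fin-induction-from : ∀ {n ℓ} (P : Pred (Fin n) ℓ) {i} → P i →
                     (∀ {j k} → toℕ k ≡ suc (toℕ j) → P j → P k) →
                     ∀ {j} → i Fin.≤ j → P j
Fin-induction-from {suc n} P Pi step =
  <-weakInduction-startingFrom P Pi (λ j → step (cong suc (sym (Fin.toℕ-inject₁ j))))

module Walks {A B : Set} (π : A → B) (R : A → A → Set) (target : B) where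

  data Walk : A → Set where
    done : ∀ {a} → π a ≡ target → Walk a
    _◅_  : ∀ {a b} → R a b → Walk b → Walk a

  vertices : ∀ {a} → Walk a → List B
  vertices {a} (done _) = π a ∷ []
  vertices {a} (_ ◅ w)  = π a ∷ vertices w

  steps : ∀ {a} → Walk a → ℕ
  steps (done _) = 0
  steps (_ ◅ w)  = suc (steps w)

  at : ∀ {a} (w : Walk a) → Fin (suc (steps w)) → A
  at {a} _       zero    = a
  at     (_ ◅ w) (suc i) = at w i

  at-∈ : ∀ {a} (w : Walk a) i → π (at w i) ∈ vertices w
  at-∈ (done _) zero    = here refl
  at-∈ (_ ◅ _)  zero    = here refl
  at-∈ (_ ◅ w)  (suc i) = there (at-∈ w i)

  target-∈ : ∀ {a} (w : Walk a) → target ∈ vertices w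
  target-∈ (done e) = here (sym e)
  target-∈ (_ ◅ w)  = there (target-∈ w)

  at-end : ∀ {a} (w : Walk a) → π (at w (fromℕ (steps w))) ≡ target
  at-end (done e) = e
  at-end (_ ◅ w)  = at-end w

  at-step : ∀ {a} (w : Walk a) i → R (at w (inject₁ i)) (at w (suc i))
  at-step (r ◅ _) zero    = r
  at-step (_ ◅ w) (suc i) = at-step w i

  at-reachable : ∀ {a} (w : Walk a) {i j} → i Fin.≤ j → Star R (at w i) (at w j)
  at-reachable w       {zero}  {zero}  _         = ε
  at-reachable (r ◅ w) {zero}  {suc j} _         = r Star.◅ at-reachable w {zero} {j} z≤n
  at-reachable (_ ◅ w) {suc i} {suc j} (s≤s i≤j) = at-reachable w i≤j

  at-injective : ∀ {a} (w : Walk a) → Unique (vertices w) → Injective _≡_ _≡_ (π ∘ at w)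
  at-injective w       _            {zero}  {zero}  _  = refl
  at-injective (_ ◅ w) (a∉w ∷ _)    {zero}  {suc j} eq = ⊥-elim (All.lookup a∉w (at-∈ w j) eq)
  at-injective (_ ◅ w) (a∉w ∷ _)    {suc i} {zero}  eq = ⊥-elim (All.lookup a∉w (at-∈ w i) (sym eq))
  at-injective (_ ◅ w) (_ ∷ w-uniq) {suc i} {suc j} eq = cong suc (at-injective w w-uniq eq)

  fromSequence : ∀ {k} (x : Fin (suc k) → A) → π (x (fromℕ k)) ≡ target →
                 (∀ i → R (x (inject₁ i)) (x (suc i))) →
                 Σ (Walk (x zero)) λ w → vertices w ≡ tabulate (π ∘ x)
  fromSequence {zero}  x end _     = done end , refl
  fromSequence {suc k} x end arrow with fromSequence (x ∘ suc) end (arrow ∘ suc)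
  ... | w , w≡x = arrow zero ◅ w , cong (π (x zero) ∷_) w≡x

  retarget : ∀ {a b} → π a ≡ π b → (∀ {c} → R b c → R a c) →
             (w : Walk b) → Σ (Walk a) λ w′ → vertices w′ ≡ vertices w
  retarget eq _ (done e) = done (trans eq e) , cong (_∷ []) eq
  retarget eq f (r ◅ w)  = f r ◅ w , cong (_∷ vertices w) eq

  -- Erasing loops by labels rather than by states needs that a state may take the steps of
  -- any later state with the same label.
  module LoopErasure
    (_≟ᴮ_ : DecidableEquality B)
    (shortcut : ∀ {a b c} → Star R a b → π a ≡ π b → R b c → R a c)
    where

    open DecMembership _≟ᴮ_ using (_∈?_)

    SimpleWalkWithin : List B → A → Set
    SimpleWalkWithin L a = Σ (Walk a) λ w → Unique (vertices w) × vertices w ⊆ L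

    widen : ∀ {L L′ a} → L ⊆ L′ → SimpleWalkWithin L a → SimpleWalkWithin L′ a
    widen L⊆L′ (w , w-uniq , w⊆L) = w , w-uniq , L⊆L′ ∘ w⊆L

    shortcutTo : ∀ {a c} → Star R a c → π a ≡ π c →
                 (w : Walk c) → Unique (vertices w) → SimpleWalkWithin (vertices w) a
    shortcutTo a↝c eq w w-uniq with retarget eq (shortcut a↝c eq) w
    ... | w′ , w′≡w = w′ , subst Unique (sym w′≡w) w-uniq , ⊆-reflexive w′≡w

    jumpTo : ∀ {a c} → Star R a c → (w : Walk c) → Unique (vertices w) →
             π a ∈ vertices w → SimpleWalkWithin (vertices w) a
    jumpTo a↝c w@(done _) w-uniq (here eq) = shortcutTo a↝c eq w w-uniq
    jumpTo a↝c w@(_ ◅ _)  w-uniq (here eq) = shortcutTo a↝c eq w w-uniq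
    jumpTo a↝c (r ◅ w) (_ ∷ w-uniq) (there a∈w) =
      widen there (jumpTo (a↝c ◅◅ Star.return r) w w-uniq a∈w)

    erase : ∀ {a} (w : Walk a) → SimpleWalkWithin (vertices w) a
    erase (done e) = done e , [] ∷ [] , id
    erase {a} (r ◅ w) with erase w
    ... | w′ , w′-uniq , w′⊆w with π a ∈? vertices w′
    ...   | yes a∈w′ = widen (there ∘ w′⊆w) (jumpTo (Star.return r) w′ w′-uniq a∈w′)
    ...   | no  a∉w′ = r ◅ w′ , All.¬Any⇒All¬ _ a∉w′ ∷ w′-uniq , ∷⁺ʳ _ w′⊆w

open Walks using (done; _◅_)

module _ {N τ : ℕ} (G : TemporalGraph N τ) (s z : Fin N) where

  -- Temporal walks are walks on states (vertex, time of the edge used to reach it).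
  TemporalStep : Fin N × Fin τ → Fin N × Fin τ → Set
  TemporalStep a b = proj₂ a Fin.≤ proj₂ b × E G (proj₁ a) (proj₁ b) (proj₂ b)

  FV : Set
  FV = FVertex G s z

  module T = Walks proj₁ TemporalStep z
  module F = Walks (id {A = FV}) (FArc G s z) snk

  reachable⇒time-≤ : ∀ {a b} → Star TemporalStep a b → proj₂ a Fin.≤ proj₂ b
  reachable⇒time-≤ = Star.fold (λ a b → proj₂ a Fin.≤ proj₂ b) (λ (t≤t′ , _) → Fin.≤-trans t≤t′) Fin.≤-refl

  temporal-shortcut : ∀ {a b c} → Star TemporalStep a b → proj₁ a ≡ proj₁ b →
                      TemporalStep b c → TemporalStep a c
  temporal-shortcut a↝b eq (t≤t′ , e) =
    Fin.≤-trans (reachable⇒time-≤ a↝b) t≤t′ , subst (λ v → E G v _ _) (sym eq) e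

  flat-shortcut : ∀ {a b c} → Star (FArc G s z) a b → a ≡ b → FArc G s z b c → FArc G s z a c
  flat-shortcut _ refl arc = arc

  mid-injective : ∀ {u v t t′} → mid {G = G} {s} {z} u t ≡ mid v t′ → u ≡ v × t ≡ t′
  mid-injective refl = refl , refl

  _≟ᶠ_ : DecidableEquality FV
  src     ≟ᶠ src      = yes refl
  snk     ≟ᶠ snk      = yes refl
  mid u t ≟ᶠ mid v t′ = map′ (λ (u≡v , t≡t′) → cong₂ mid u≡v t≡t′) mid-injective ((u ≟ v) ×-dec (t ≟ t′))
  src     ≟ᶠ snk      = no λ ()
  src     ≟ᶠ mid _ _  = no λ ()
  snk     ≟ᶠ src      = no λ ()
  snk     ≟ᶠ mid _ _  = no λ ()
  mid _ _ ≟ᶠ src      = no λ ()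
  mid _ _ ≟ᶠ snk      = no λ ()

  module TE = T.LoopErasure _≟_ temporal-shortcut
  module FE = F.LoopErasure _≟ᶠ_ flat-shortcut

  toTemporalPath : ∀ {t₀} (w : T.Walk (s , t₀)) → Unique (T.vertices w) → TemporalPath G s z
  toTemporalPath w w-uniq = record
    { k     = T.steps w
    ; x     = proj₁ ∘ T.at w
    ; t     = proj₂ ∘ T.at w ∘ suc
    ; start = refl
    ; end   = T.at-end w
    ; edge  = proj₂ ∘ T.at-step w
    ; mono  = λ _ _ i≤j → reachable⇒time-≤ (T.at-reachable w (s≤s i≤j))
    ; inj   = T.at-injective w w-uniq
    }

  toFlatPath : (w : F.Walk src) → Unique (F.vertices w) → FlatPath G s z
  toFlatPath w w-uniq = record
    { k     = F.steps w
    ; x     = F.at w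
    ; start = refl
    ; end   = F.at-end w
    ; arc   = F.at-step w
    ; inj   = F.at-injective w w-uniq
    }

  fromFlatPath : (P : FlatPath G s z) → Σ (F.Walk src) λ w → F.vertices w ≡ tabulate (FlatPath.x P)
  fromFlatPath P = subst (λ a → Σ (F.Walk a) λ w → F.vertices w ≡ tabulate x) start
                         (F.fromSequence x end arc)
    where open FlatPath P

  fromTemporalPath : s ≢ z → (P : TemporalPath G s z) →
                     ∃ λ t₀ → Σ (T.Walk (s , t₀)) λ w → T.vertices w ≡ tabulate (TemporalPath.x P)
  fromTemporalPath s≢z record { k = zero ; start = start ; end = end } = ⊥-elim (s≢z (trans (sym start) end))
  fromTemporalPath s≢z record { k = suc k ; x = x ; t = t ; start = start ; end = end ; edge = edge ; mono = mono } =
    t zero , subst (λ v → Σ (T.Walk (v , t zero)) λ w → T.vertices w ≡ tabulate x) start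
                   (T.fromSequence moment end step)
    where
    moment : Fin (suc (suc k)) → Fin N × Fin τ
    moment zero    = x zero , t zero
    moment (suc i) = x (suc i) , t i
    step : ∀ i → TemporalStep (moment (inject₁ i)) (moment (suc i))
    step zero    = Fin.≤-refl , edge zero
    step (suc i) = mono _ _ (Fin.i≤inject₁[j]⇒i≤1+j Fin.≤-refl) , edge (suc i)

  project : FV → Fin N
  project src       = s
  project snk       = z
  project (mid v _) = v

  copy-of-inner : ∀ a {v} → v ≡ project a → v ≢ s → v ≢ z → ∃ λ t → a ≡ mid v t
  copy-of-inner src       v≡s v≢s _   = ⊥-elim (v≢s v≡s)
  copy-of-inner snk       v≡z _   v≢z = ⊥-elim (v≢z v≡z)
  copy-of-inner (mid _ t) refl _  _   = t , refl

  copy-in-sequence : ∀ {k v} (x : Fin k → FV) → v ≢ s → v ≢ z →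
                     v ∈ map project (tabulate x) → ∃ λ j → ∃ λ t → x j ≡ mid v t
  copy-in-sequence x v≢s v≢z v∈x with ∈-map⁻ project v∈x
  ... | a , a∈x , v≡a with ∈-tabulate⁻ {f = x} a∈x
  ... | j , refl = j , copy-of-inner (x j) v≡a v≢s v≢z

  projectWalk : ∀ {v t} (fw : F.Walk (mid v t)) →
                Σ (T.Walk (v , t)) λ w → T.vertices w ⊆ map project (F.vertices fw)
  projectWalk (edgeArc _ _ _ _ e ◅ fw) with projectWalk fw
  ... | w , w⊆fw = (Fin.≤-refl , e) ◅ w , ∷⁺ʳ _ w⊆fw
  projectWalk {t = t} (timeArc {t′ = t′} _ _ t′≡1+t ◅ fw) with projectWalk fw
  ... | w , w⊆fw with T.retarget refl (λ (t′≤t″ , e) → Fin.≤-trans t≤t′ t′≤t″ , e) w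
    where
    t≤t′ : t Fin.≤ t′
    t≤t′ = ℕ.≤-trans (ℕ.n≤1+n (toℕ t)) (ℕ.≤-reflexive (sym t′≡1+t))
  ... | w′ , w′≡w = w′ , there ∘ w⊆fw ∘ ⊆-reflexive w′≡w
  projectWalk (snkArc _ _ e ◅ done _) = (Fin.≤-refl , E-sym G _ _ _ e) ◅ done refl , id
  projectWalk (snkArc _ _ _ ◅ (() ◅ _))

  projectSourceWalk : (fw : F.Walk src) →
                ∃ λ t₀ → Σ (T.Walk (s , t₀)) λ w → T.vertices w ⊆ map project (F.vertices fw)
  projectSourceWalk (srcArc {t = t} _ _ e ◅ fw) with projectWalk fw
  ... | w , w⊆fw = t , (Fin.≤-refl , e) ◅ w , ∷⁺ʳ _ w⊆fw

  WalkOver : (Fin N → Set) → FV → Set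
  WalkOver Y a = Σ (F.Walk a) λ fw → All (Y ∘ project) (F.vertices fw)

  climb : ∀ {Y v t₀ t} → v ≢ s → v ≢ z → Y v → t₀ Fin.≤ t → WalkOver Y (mid v t) → WalkOver Y (mid v t₀)
  climb {Y} {v} {t₀} v≢s v≢z yv =
    Fin-induction-from (λ t → WalkOver Y (mid v t) → WalkOver Y (mid v t₀)) id
      (λ t′≡1+t climb-from-t (fw , over) → climb-from-t (timeArc v≢s v≢z t′≡1+t ◅ fw , yv ∷ over))

  liftWalk : ∀ {Y v t} (w : T.Walk (v , t)) → v ≢ z →
             All (_≢ s) (T.vertices w) → All Y (T.vertices w) → WalkOver Y (mid v t)
  liftWalk (done v≡z) v≢z _ _ = ⊥-elim (v≢z v≡z)
  liftWalk (_◅_ {b = u , _} (t≤t′ , e) w) v≢z (v≢s ∷ w≢s) (yv ∷ yw) with u ≟ z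
  ... | yes refl =
    climb v≢s v≢z yv t≤t′ (snkArc v≢s v≢z (E-sym G _ _ _ e) ◅ done refl , yv ∷ All.lookup yw (T.target-∈ w) ∷ [])
  ... | no u≢z with liftWalk w u≢z w≢s yw
  ...   | fw , over =
    climb v≢s v≢z yv t≤t′ (edgeArc v≢s v≢z (All.lookup w≢s (T.at-∈ w zero)) u≢z e ◅ fw , yv ∷ over)

  liftSourceWalk : ∀ {Y t₀} → s ≢ z → (∀ t → ¬ E G s z t) → (w : T.Walk (s , t₀)) →
             Unique (T.vertices w) → All Y (T.vertices w) → WalkOver Y src
  liftSourceWalk s≢z _ (done s≡z) _ _ = ⊥-elim (s≢z s≡z)
  liftSourceWalk s≢z no-sz (_◅_ {b = v , t} (_ , e) w) (s∉w ∷ _) (ys ∷ yw) with v ≟ z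
  ... | yes refl = ⊥-elim (no-sz t e)
  ... | no v≢z with liftWalk w v≢z (All.map ≢-sym s∉w) yw
  ...   | fw , over = srcArc (≢-sym (All.lookup s∉w (T.at-∈ w zero))) v≢z e ◅ fw , ys ∷ over

  projectFlatPath : (P : FlatPath G s z) →
    Σ (TemporalPath G s z) λ P′ → ∀ i → TemporalPath.x P′ i ∈ map project (tabulate (FlatPath.x P))
  projectFlatPath P with fromFlatPath P
  ... | fw , fw≡P with projectSourceWalk fw
  ... | _ , w , w⊆fw with TE.erase w
  ... | w′ , w′-uniq , w′⊆w =
    toTemporalPath w′ w′-uniq , λ i → subst (_ ∈_) (cong (map project) fw≡P) (w⊆fw (w′⊆w (T.at-∈ w′ i)))

  -- F(G) has no arc src → snk, so a temporal path made of a single s–z edge has no flat counterpart.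
  liftTemporalPath : s ≢ z → (∀ t → ¬ E G s z t) → (P : TemporalPath G s z) →
    Σ (FlatPath G s z) λ P′ → ∀ i → project (FlatPath.x P′ i) ∈ tabulate (TemporalPath.x P)
  liftTemporalPath s≢z no-sz P with fromTemporalPath s≢z P
  ... | _ , w , w≡P with TE.erase w
  ... | w′ , w′-uniq , w′⊆w with liftSourceWalk s≢z no-sz w′ w′-uniq (All.tabulate w′⊆w)
  ... | fw , over with FE.erase fw
  ... | fw′ , fw′-uniq , fw′⊆fw =
    toFlatPath fw′ fw′-uniq , λ i → subst (_ ∈_) w≡P (All.lookup over (fw′⊆fw (F.at-∈ fw′ i)))

  flatten-separator : ∀ S → TemporalSeparator G s z S → FlatSeparator G s z (cartesianProduct S (allFin τ))
  flatten-separator S (S-uniq , S-inner , meets) =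
    Unique.cartesianProduct⁺ S-uniq (Unique.allFin⁺ τ) ,
    All.tabulate (λ p∈S′ → All.lookup S-inner (proj₁ (∈-cartesianProduct⁻ S (allFin τ) p∈S′))) ,
    meets-flat
    where
    meets-flat : (P : FlatPath G s z) → ∃ λ i → Σ (Fin N × Fin τ) λ p →
                 p ∈ cartesianProduct S (allFin τ) × FlatPath.x P i ≡ mid (proj₁ p) (proj₂ p)
    meets-flat P with projectFlatPath P
    ... | P′ , P′⊆P with meets P′
    ... | i , v∈S with All.lookup S-inner v∈S
    ... | v≢s , v≢z with copy-in-sequence (FlatPath.x P) v≢s v≢z (P′⊆P i)
    ... | j , t , Pj≡vt = j , (_ , t) , ∈-cartesianProduct⁺ v∈S (∈-allFin t) , Pj≡vt

  project-separator : s ≢ z → (∀ t → ¬ E G s z t) →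
                      ∀ S′ → FlatSeparator G s z S′ → TemporalSeparator G s z (deduplicate _≟_ (map proj₁ S′))
  project-separator s≢z no-sz S′ (_ , S′-inner , meets) =
    Unique.deduplicate-! _≟_ (map proj₁ S′) ,
    All.deduplicate⁺ _≟_ (All.map⁺ S′-inner) ,
    meets-temporal
    where
    meets-temporal : (P : TemporalPath G s z) → ∃ λ i → TemporalPath.x P i ∈ deduplicate _≟_ (map proj₁ S′)
    meets-temporal P with liftTemporalPath s≢z no-sz P
    ... | P′ , P′⊆P with meets P′
    ... | i , p , p∈S′ , P′i≡p with ∈-tabulate⁻ (subst (_∈ _) (cong project P′i≡p) (P′⊆P i))
    ... | j , p≡Pj = j , subst (_∈ _) p≡Pj (∈-deduplicate⁺ _≟_ (∈-map⁺ proj₁ p∈S′))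

theorem4 : {N τ : ℕ} (G : TemporalGraph N τ) (s z : Fin N) → s ≢ z →
    ((S : List (Fin N)) → TemporalSeparator G s z S →
       ∃ λ S′ → FlatSeparator G s z S′ × length S′ ≤ τ * length S)
    ×
    ((∀ t → ¬ E G s z t) →
     (S′ : List (Fin N × Fin τ)) → FlatSeparator G s z S′ →
       ∃ λ S → TemporalSeparator G s z S × length S ≤ length S′)
theorem4 {τ = τ} G s z s≢z =
  (λ S S-sep → cartesianProduct S (allFin τ) , flatten-separator G s z S S-sep , ℕ.≤-reflexive (size S)) ,
  (λ no-sz S′ S′-sep → deduplicate _≟_ (map proj₁ S′) , project-separator G s z s≢z no-sz S′ S′-sep ,
     ℕ.≤-trans (length-deduplicate _≟_ (map proj₁ S′)) (ℕ.≤-reflexive (length-map proj₁ S′)))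
  where
  size : ∀ S → length (cartesianProduct S (allFin τ)) ≡ τ * length S
  size S = trans (length-cartesianProduct S (allFin τ))
                 (trans (cong (length S *_) (length-tabulate id)) (ℕ.*-comm (length S) τ))
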